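{- Let $X$ be a Priestley space. Then $(\mathsf{CC}(X),\unlhd)$ is a root system, i.e., $\unlhd$ is a partial order and for every $C\in\mathsf{CC}(X)$ the set $\{K\in\mathsf{CC}(X)\mid C\unlhd K\}$ is totally ordered by $\unlhd$.
   Context: A Priestley space is a compact space with a partial order such that $x\not\le y$ implies a clopen upset containing $x$ but not $y$. $\mathsf{CC}(X)$ is the set of nonempty closed chains (totally ordered closed subsets) of $X$, and $C_1\unlhd C_2$ iff $C_2\subseteq C_1$ and $C_2$ is an upset of $C_1$ (with respect to the order of $X$). -}

module Defs where

open import Level using (0ℓ) renaming (suc to lsuc)
open import Data.Product using (Σ; ∃; _×_; _,_; proj₁)
open import Data.Sum using (_⊎_)
open import Data.List using (List)
open import Data.Unit using (⊤)
open import Data.Empty using (⊥)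
open import Data.List.Relation.Unary.Any using (Any)
open import Relation.Nullary using (¬_)
open import Relation.Unary using (Pred; _∈_; _∉_; _⊆_; _≐_; ∁; _∩_; Satisfiable; ⋃)
open import Relation.Binary.PropositionalEquality using (_≡_)
open import Relation.Binary.Structures using (IsPartialOrder)

record IsTopology (X : Set) (Open : Pred X 0ℓ → Set) : Set₁ where
  field
    open-empty : Open (λ _ → ⊥)
    open-whole : Open (λ _ → ⊤)
    open-∩     : ∀ {U V} → Open U → Open V → Open (U ∩ V)
    open-⋃     : (I : Set) (U : I → Pred X 0ℓ) → (∀ i → Open (U i))
                 → Open (λ x → Σ I (λ i → x ∈ U i))

record PriestleySpace : Set₁ where
  field
    Carrier : Set
    Open    : Pred Carrier 0ℓ → Set
    _≤_     : Carrier → Carrier → Set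
    isTopology     : IsTopology Carrier Open
    isPartialOrder : IsPartialOrder _≡_ _≤_

  Closed : Pred Carrier 0ℓ → Set
  Closed C = Open (∁ C)

  Clopen : Pred Carrier 0ℓ → Set
  Clopen U = Open U × Closed U

  IsUpset : Pred Carrier 0ℓ → Set
  IsUpset U = ∀ {x y} → x ∈ U → x ≤ y → y ∈ U

  field
    compact : (I : Set) (U : I → Pred Carrier 0ℓ) → (∀ i → Open (U i))
              → (∀ x → Σ I (λ i → x ∈ U i))
              → Σ (List I) (λ is → ∀ x → Any (λ i → x ∈ U i) is)
    separation : ∀ x y → ¬ (x ≤ y)
                 → Σ (Pred Carrier 0ℓ) (λ U → Clopen U × IsUpset U × x ∈ U × y ∉ U)

  IsChain : Pred Carrier 0ℓ → Set
  IsChain C = ∀ {x y} → x ∈ C → y ∈ C → (x ≤ y) ⊎ (y ≤ x)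

  record IsClosedChain (C : Pred Carrier 0ℓ) : Set where
    field
      closed   : Closed C
      chain    : IsChain C
      nonempty : Satisfiable C

  CC : Set₁
  CC = Σ (Pred Carrier 0ℓ) IsClosedChain

  _≈CC_ : CC → CC → Set
  C₁ ≈CC C₂ = proj₁ C₁ ≐ proj₁ C₂

  _⊴_ : CC → CC → Set
  C₁ ⊴ C₂ = (proj₁ C₂ ⊆ proj₁ C₁)
            × (∀ {x y} → x ∈ proj₁ C₂ → y ∈ proj₁ C₁ → x ≤ y → y ∈ proj₁ C₂)

IsRootSystem : {A : Set₁} (_≈_ _⊑_ : A → A → Set) → Set₁
IsRootSystem {A} _≈_ _⊑_ =
  IsPartialOrder _≈_ _⊑_
  × (∀ (C K₁ K₂ : A) → C ⊑ K₁ → C ⊑ K₂ → (K₁ ⊑ K₂) ⊎ (K₂ ⊑ K₁))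

-- Only the order matters, not the topology.  If C ⊴ K₁ and C ⊴ K₂, then K₁ and
-- K₂ are up-sets of the chain C, so for x ∈ K₁ and y ∈ K₂ comparing x with y
-- puts y in K₁ or x in K₂.  Classically this exchange property forces one of
-- K₁, K₂ to contain the other, and the larger one is then ⊴-below the smaller.
module Submission where

open import Defs
open import Level using (0ℓ)
open import Axiom.ExcludedMiddle using (ExcludedMiddle)
open import Data.Product using (_,_; proj₁; proj₂)
open import Data.Sum using (_⊎_; inj₁; inj₂; map)
open import Data.Empty using (⊥-elim)
open import Relation.Nullary using (yes; no)
open import Relation.Unary using (Pred; _∈_; _⊆_)
open import Relation.Unary.Properties using (≐-refl; ≐-sym; ≐-trans)
open import Relation.Binary.Structures using (IsPartialOrder)

exchange⇒⊆-total : ExcludedMiddle 0ℓ → {A : Set} {P Q : Pred A 0ℓ}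
                    → (∀ {x y} → x ∈ P → y ∈ Q → x ∈ Q ⊎ y ∈ P)
                    → P ⊆ Q ⊎ Q ⊆ P
exchange⇒⊆-total lem {P = P} {Q} exchange with lem {Q ⊆ P}
... | yes Q⊆P = inj₂ Q⊆P
... | no Q⊈P = inj₁ P⊆Q
  where
  P⊆Q : P ⊆ Q
  P⊆Q {x} x∈P with lem {x ∈ Q}
  ... | yes x∈Q = x∈Q
  ... | no x∉Q = ⊥-elim (Q⊈P Q⊆P)
    where
    Q⊆P : Q ⊆ P
    Q⊆P y∈Q with exchange x∈P y∈Q
    ... | inj₁ x∈Q = ⊥-elim (x∉Q x∈Q)
    ... | inj₂ y∈P = y∈P

module _ (X : PriestleySpace) where
  open PriestleySpace X

  ⊴-isPartialOrder : IsPartialOrder _≈CC_ _⊴_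
  ⊴-isPartialOrder = record
    { isPreorder = record
      { isEquivalence = record { refl = ≐-refl ; sym = ≐-sym ; trans = ≐-trans }
      ; reflexive     = λ (C⊆K , K⊆C) → K⊆C , λ _ y∈C _ → C⊆K y∈C
      ; trans         = λ (K⊆C , C↑K) (L⊆K , K↑L) →
          (λ z∈L → K⊆C (L⊆K z∈L))
          , λ x∈L y∈C x≤y → K↑L x∈L (C↑K (L⊆K x∈L) y∈C x≤y) x≤y
      }
    ; antisym = λ (K⊆C , _) (C⊆K , _) → C⊆K , K⊆C
    }

  ⊴-exchange : ∀ C K₁ K₂ → C ⊴ K₁ → C ⊴ K₂
             → ∀ {x y} → x ∈ proj₁ K₁ → y ∈ proj₁ K₂ → x ∈ proj₁ K₂ ⊎ y ∈ proj₁ K₁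
  ⊴-exchange C K₁ K₂ (K₁⊆C , C↑K₁) (K₂⊆C , C↑K₂) x∈K₁ y∈K₂
    with IsClosedChain.chain (proj₂ C) (K₁⊆C x∈K₁) (K₂⊆C y∈K₂)
  ... | inj₁ x≤y = inj₂ (C↑K₁ x∈K₁ (K₂⊆C y∈K₂) x≤y)
  ... | inj₂ y≤x = inj₁ (C↑K₂ y∈K₂ (K₁⊆C x∈K₁) y≤x)

  ⊆⇒⊴ : ∀ C K₁ K₂ → C ⊴ K₁ → C ⊴ K₂ → proj₁ K₂ ⊆ proj₁ K₁ → K₁ ⊴ K₂
  ⊆⇒⊴ C K₁ K₂ (K₁⊆C , _) (_ , C↑K₂) K₂⊆K₁ =
    K₂⊆K₁ , λ x∈K₂ y∈K₁ x≤y → C↑K₂ x∈K₂ (K₁⊆C y∈K₁) x≤y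

theorem3p8 : ExcludedMiddle 0ℓ → (X : PriestleySpace)
    → IsRootSystem (PriestleySpace._≈CC_ X) (PriestleySpace._⊴_ X)
theorem3p8 lem X = ⊴-isPartialOrder X , comparable
  where
  open PriestleySpace X

  comparable : ∀ (C K₁ K₂ : CC) → C ⊴ K₁ → C ⊴ K₂ → (K₁ ⊴ K₂) ⊎ (K₂ ⊴ K₁)
  comparable C K₁ K₂ C⊴K₁ C⊴K₂ =
    map (⊆⇒⊴ X C K₁ K₂ C⊴K₁ C⊴K₂) (⊆⇒⊴ X C K₂ K₁ C⊴K₂ C⊴K₁)
        (exchange⇒⊆-total lem (⊴-exchange X C K₂ K₁ C⊴K₂ C⊴K₁))
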